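{- The Eulerian polynomials $A_n(q)=\sum_{k=0}^nA(n,k)q^k$, $n\ge0$, form a $q$-log-convex sequence.
   Context: $A(n,k)$ is the Eulerian number: the number of permutations of $\{1,\dots,n\}$ with exactly $k-1$ descents (equivalently, $A(n,k)=kA(n-1,k)+(n-k+1)A(n-1,k-1)$ with $A(0,0)=1$ and $A(n,k)=0$ unless $0\le k\le n$). For real polynomials, $f(q)\le_q g(q)$ means $g-f$ has nonnegative coefficients; $\{P_n(q)\}_{n\ge0}$ is $q$-log-convex if $P_n(q)^2\le_q P_{n-1}(q)P_{n+1}(q)$ for all $n\ge1$. -}

module Defs where

open import Data.Nat using (ℕ; zero; suc; _+_; _*_; _∸_; _≤_)

eulerian : ℕ → ℕ → ℕ
eulerian zero    zero    = 1
eulerian zero    (suc k) = 0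
eulerian (suc n) zero    = 0   -- k*A(n,0) + (n+2)*A(n,-1) with k = 0 and A(n,-1) = 0
eulerian (suc n) (suc k) =
  suc k * eulerian n (suc k) + (suc n ∸ suc k + 1) * eulerian n k
-- note: for k+1 > n+1 we have eulerian n k = 0 (k > n), so the truncated
-- subtraction never matters.

-- A polynomial with natural-number coefficients, as its coefficient function.
Poly : Set
Poly = ℕ → ℕ

eulerPoly : ℕ → Poly
eulerPoly n k = eulerian n k

sumTo : ℕ → (ℕ → ℕ) → ℕ
sumTo zero    f = f 0
sumTo (suc m) f = sumTo m f + f (suc m)

_·_ : Poly → Poly → Poly
(f · g) m = sumTo m (λ i → f i * g (m ∸ i))

_≤q_ : Poly → Poly → Set
f ≤q g = ∀ m → f m ≤ g m

QLogConvex : (ℕ → Poly) → Set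
QLogConvex P = ∀ n → 1 ≤ n → (P n · P n) ≤q (P (n ∸ 1) · P (suc n))

-- The Eulerian polynomials form the first column of the Jacobi tableau
--   T(0, h) = [h = 0],   T(n+1, h) = T(n, h-1) + b_h T(n, h) + c_h T(n, h+1),
-- with b_h = h + (h+1) q and c_h = (h+1)² q (the J-fraction of Σ A_n(q) tⁿ).
-- Rows n+1, n+2 arise from rows n, n+1 by the tridiagonal matrix of the b's and c's,
-- whose 2×2 minors are q-nonnegative because c_h ≤_q b_h b_(h+1); a Cauchy–Binet
-- expansion, written without subtraction in the preorder x ≼ y ⇔ ∃ d, x + d = y of a
-- commutative semiring, shows by induction that all 2×2 minors of two consecutive rows
-- are q-nonnegative. One more step of the recurrence turns the minor in columns 0, 1 of
-- rows n, n+1 into A_(n+1)² ≤_q A_n A_(n+2).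
-- To identify the first column, the coefficients E n h k of T(n, h) are defined by the
-- refined Eulerian recurrence E(n+1,h,k) = E(n,h-1,k) + (h+k) E(n,h,k) + (n+2-k) E(n,h,k-1);
-- it implies the tableau recurrence through the identity
--   (k+1) E(n,h,k+1) + n E(n,h,k) = (h+1)² E(n,h+1,k) + (k+h) E(n,h,k),
-- proved by induction on n over ℤ.

module Submission where

open import Defs
open import Algebra.Bundles using (CommutativeSemiring)
open import Data.Nat as ℕ using (ℕ; zero; suc; _≤_; z≤n; s≤s)
open import Data.Nat.Properties as ℕ using (m≤n⇒m<n∨m≡n; m≤n⇒m≤1+n)
open import Data.Product using (_,_; ∃-syntax)
open import Data.Sum using (inj₁; inj₂)
open import Level using (_⊔_)
open import Relation.Binary.Bundles using (Preorder)
import Relation.Binary.PropositionalEquality as ≡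

module JacobiTableau {a ℓ} (R : CommutativeSemiring a ℓ) where

  open CommutativeSemiring R
  open import Algebra.Properties.CommutativeSemigroup +-commutativeSemigroup using (interchange)
  open import Algebra.Solver.Ring.NaturalCoefficients.Default R using (solve; _:+_; _:*_; _:=_; con)

  private
    variable
      w x y z : Carrier
      α₁ α₂ β₁ β₂ : Carrier
      X Y : ℕ → Carrier
      m n : ℕ

  infix 4 _≼_
  _≼_ : Carrier → Carrier → Set (a ⊔ ℓ)
  x ≼ y = ∃[ d ] x + d ≈ y

  ≈⇒≼ : x ≈ y → x ≼ y
  ≈⇒≼ {x} x≈y = 0# , trans (+-identityʳ x) x≈y

  ≼-refl : x ≼ x
  ≼-refl = ≈⇒≼ refl

  ≼-trans : x ≼ y → y ≼ z → x ≼ z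
  ≼-trans {x} (d , x+d≈y) (e , y+e≈z) =
    d + e , trans (sym (+-assoc x d e)) (trans (+-congʳ x+d≈y) y+e≈z)

  ≼-preorder : Preorder a ℓ (a ⊔ ℓ)
  ≼-preorder = record
    { _≈_ = _≈_
    ; _≲_ = _≼_
    ; isPreorder = record { isEquivalence = isEquivalence ; reflexive = ≈⇒≼ ; trans = ≼-trans }
    }

  open import Relation.Binary.Reasoning.Preorder ≼-preorder

  0≼ : 0# ≼ x
  0≼ {x} = x , +-identityˡ x

  +-mono-≼ : w ≼ x → y ≼ z → w + y ≼ x + z
  +-mono-≼ {w} {y = y} (d , w+d≈x) (e , y+e≈z) =
    d + e , trans (interchange w y d e) (+-cong w+d≈x y+e≈z)

  *-monoʳ-≼ : x ≼ y → z * x ≼ z * y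
  *-monoʳ-≼ {x} {z = z} (d , x+d≈y) = z * d , trans (sym (distribˡ z x d)) (*-congˡ x+d≈y)

  -- If y = x + d and z = w + e, the right-hand side exceeds the left-hand side by e * d.
  rearrangement : x ≼ y → w ≼ z → w * y + z * x ≼ w * x + z * y
  rearrangement {x} {y} {w} {z} (d , x+d≈y) (e , w+e≈z) = e * d , (begin-equality
    w * y + z * x + e * d             ≈⟨ +-congʳ (+-cong (*-congˡ x+d≈y) (*-congʳ w+e≈z)) ⟨
    w * (x + d) + (w + e) * x + e * d ≈⟨ solve 4 (λ w x d e → w :* (x :+ d) :+ (w :+ e) :* x :+ e :* d
                                                         := w :* x :+ (w :+ e) :* (x :+ d)) refl w x d e ⟩
    w * x + (w + e) * (x + d)         ≈⟨ +-congˡ (*-cong w+e≈z x+d≈y) ⟩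
    w * x + z * y                     ∎)

  TP₂ : (X Y : ℕ → Carrier) → Set (a ⊔ ℓ)
  TP₂ X Y = ∀ {m n} → n ≤ m → X m * Y n ≼ X n * Y m

  combination : Carrier → Carrier → (ℕ → Carrier) → ℕ → Carrier
  combination α₁ α₂ X m = X m + α₁ * X (suc m) + α₂ * X (suc (suc m))

  private
    -- Σ αᵢ βⱼ w i j over i, j ≤ 2 (with α₀ = β₀ = 1); the terms (0, 2) and (1, 1),
    -- which are compared jointly when the two windows overlap, are kept apart.
    expansion : (α₁ α₂ β₁ β₂ : Carrier) → (ℕ → ℕ → Carrier) → Carrier
    expansion α₁ α₂ β₁ β₂ w =
      (w 0 0 + β₁ * w 0 1 + α₁ * w 1 0 + (α₁ * β₂) * w 1 2
        + α₂ * w 2 0 + (α₂ * β₁) * w 2 1 + (α₂ * β₂) * w 2 2)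
      + (β₂ * w 0 2 + (β₁ * α₁) * w 1 1)

    combination-*-combination : combination α₁ α₂ X m * combination β₁ β₂ Y n
                              ≈ expansion α₁ α₂ β₁ β₂ (λ i j → X (i ℕ.+ m) * Y (j ℕ.+ n))
    combination-*-combination {α₁} {α₂} {X} {m} {β₁} {β₂} {Y} {n} =
      solve 10 (λ α₁ α₂ β₁ β₂ x₀ x₁ x₂ y₀ y₁ y₂ →
        (x₀ :+ α₁ :* x₁ :+ α₂ :* x₂) :* (y₀ :+ β₁ :* y₁ :+ β₂ :* y₂) :=
        (x₀ :* y₀ :+ β₁ :* (x₀ :* y₁) :+ α₁ :* (x₁ :* y₀) :+ (α₁ :* β₂) :* (x₁ :* y₂)
          :+ α₂ :* (x₂ :* y₀) :+ (α₂ :* β₁) :* (x₂ :* y₁) :+ (α₂ :* β₂) :* (x₂ :* y₂))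
        :+ (β₂ :* (x₀ :* y₂) :+ (β₁ :* α₁) :* (x₁ :* y₁)))
        refl α₁ α₂ β₁ β₂ (X m) (X (suc m)) (X (suc (suc m))) (Y n) (Y (suc n)) (Y (suc (suc n)))

    combination-*-combination′ : combination β₁ β₂ X n * combination α₁ α₂ Y m
                               ≈ expansion α₁ α₂ β₁ β₂ (λ i j → X (j ℕ.+ n) * Y (i ℕ.+ m))
    combination-*-combination′ {β₁} {β₂} {X} {n} {α₁} {α₂} {Y} {m} =
      solve 10 (λ α₁ α₂ β₁ β₂ x₀ x₁ x₂ y₀ y₁ y₂ →
        (x₀ :+ β₁ :* x₁ :+ β₂ :* x₂) :* (y₀ :+ α₁ :* y₁ :+ α₂ :* y₂) :=
        (x₀ :* y₀ :+ β₁ :* (x₁ :* y₀) :+ α₁ :* (x₀ :* y₁) :+ (α₁ :* β₂) :* (x₂ :* y₁)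
          :+ α₂ :* (x₀ :* y₂) :+ (α₂ :* β₁) :* (x₁ :* y₂) :+ (α₂ :* β₂) :* (x₂ :* y₂))
        :+ (β₂ :* (x₂ :* y₀) :+ (β₁ :* α₁) :* (x₁ :* y₁)))
        refl α₁ α₂ β₁ β₂ (X n) (X (suc n)) (X (suc (suc n))) (Y m) (Y (suc m)) (Y (suc (suc m)))

    expansion-mono : ∀ {w w′ : ℕ → ℕ → Carrier} →
                     (∀ {i j} → j ≤ suc i → w i j ≼ w′ i j) →
                     β₂ * w 0 2 + (β₁ * α₁) * w 1 1 ≼ β₂ * w′ 0 2 + (β₁ * α₁) * w′ 1 1 →
                     expansion α₁ α₂ β₁ β₂ w ≼ expansion α₁ α₂ β₁ β₂ w′
    expansion-mono w≼w′ corner =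
      +-mono-≼ (+-mono-≼ (+-mono-≼ (+-mono-≼ (+-mono-≼ (+-mono-≼ (+-mono-≼
        (w≼w′ z≤n)
        (*-monoʳ-≼ (w≼w′ (s≤s z≤n))))
        (*-monoʳ-≼ (w≼w′ z≤n)))
        (*-monoʳ-≼ (w≼w′ (s≤s (s≤s z≤n)))))
        (*-monoʳ-≼ (w≼w′ z≤n)))
        (*-monoʳ-≼ (w≼w′ (s≤s z≤n))))
        (*-monoʳ-≼ (w≼w′ (s≤s (s≤s z≤n)))))
      corner

  combination-*-≼ :
    (∀ {i j} → j ≤ suc i → X (i ℕ.+ m) * Y (j ℕ.+ n) ≼ X (j ℕ.+ n) * Y (i ℕ.+ m)) →
    β₂ * (X m * Y (suc (suc n))) + (β₁ * α₁) * (X (suc m) * Y (suc n))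
      ≼ β₂ * (X (suc (suc n)) * Y m) + (β₁ * α₁) * (X (suc n) * Y (suc m)) →
    combination α₁ α₂ X m * combination β₁ β₂ Y n ≼ combination β₁ β₂ X n * combination α₁ α₂ Y m
  combination-*-≼ {X} {m} {Y} {n} {β₂} {β₁} {α₁} {α₂} pairs corner = begin
    combination α₁ α₂ X m * combination β₁ β₂ Y n
      ≈⟨ combination-*-combination {α₁} {α₂} {X} {m} {β₁} {β₂} {Y} {n} ⟩
    expansion α₁ α₂ β₁ β₂ (λ i j → X (i ℕ.+ m) * Y (j ℕ.+ n))
      ≲⟨ expansion-mono pairs corner ⟩
    expansion α₁ α₂ β₁ β₂ (λ i j → X (j ℕ.+ n) * Y (i ℕ.+ m))
      ≈⟨ combination-*-combination′ {β₁} {β₂} {X} {n} {α₁} {α₂} {Y} {m} ⟨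
    combination β₁ β₂ X n * combination α₁ α₂ Y m
      ∎

  shift : (ℕ → Carrier) → ℕ → Carrier
  shift X zero    = 0#
  shift X (suc h) = X h

  TP₂-shift : TP₂ X Y → TP₂ (shift X) (shift Y)
  TP₂-shift {X} {Y} _ {m} {zero} _ = begin
    shift X m * 0# ≈⟨ zeroʳ (shift X m) ⟩
    0#             ≲⟨ 0≼ ⟩
    0# * shift Y m ∎
  TP₂-shift tp {suc m} {suc n} (s≤s n≤m) = tp n≤m

  module _ (b c : ℕ → Carrier) where

    next : (ℕ → Carrier) → ℕ → Carrier
    next X h = combination (b h) (c h) (shift X) h

    next-cong : (∀ h → X h ≈ Y h) → ∀ h → next X h ≈ next Y h
    next-cong X≈Y zero    = +-cong (+-congˡ (*-congˡ (X≈Y 0))) (*-congˡ (X≈Y 1))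
    next-cong X≈Y (suc h) = +-cong (+-cong (X≈Y h) (*-congˡ (X≈Y (suc h)))) (*-congˡ (X≈Y (suc (suc h))))

    -- The single out-of-order product X (1+n) Y (2+n) is paired with X (2+n) Y (1+n).
    next-*-≼-adjacent : TP₂ X Y → c n ≼ b n * b (suc n) →
                        next X (suc n) * next Y n ≼ next X n * next Y (suc n)
    next-*-≼-adjacent {X} {Y} {n} tp cₙ≼bₙbₙ₊₁ =
      combination-*-≼ {X = shift X} {m = suc n} {Y = shift Y} {n = n}
                      {β₂ = c n} {β₁ = b n} {α₁ = b (suc n)} {α₂ = c (suc n)}
                      pairs (rearrangement (TP₂-shift tp (ℕ.n≤1+n (suc n))) cₙ≼bₙbₙ₊₁)
      where
      pairs : ∀ {i j} → j ≤ suc i →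
              shift X (i ℕ.+ suc n) * shift Y (j ℕ.+ n) ≼ shift X (j ℕ.+ n) * shift Y (i ℕ.+ suc n)
      pairs {i} {j} j≤1+i = TP₂-shift tp
        (ℕ.≤-trans (ℕ.+-monoˡ-≤ n j≤1+i) (ℕ.≤-reflexive (≡.sym (ℕ.+-suc i n))))

    next-*-≼-distant : TP₂ X Y → n ≤ m →
                       next X (suc (suc m)) * next Y n ≼ next X n * next Y (suc (suc m))
    next-*-≼-distant {X} {Y} {n} {m} tp n≤m =
      combination-*-≼ {X = shift X} {m = suc (suc m)} {Y = shift Y} {n = n}
                      {β₂ = c n} {β₁ = b n} {α₁ = b (suc (suc m))} {α₂ = c (suc (suc m))}
                      pairs (+-mono-≼ (*-monoʳ-≼ (TP₂-shift tp (s≤s (s≤s n≤m))))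
                                      (*-monoʳ-≼ (pairs {1} {1} (s≤s z≤n))))
      where
      pairs : ∀ {i j} → j ≤ suc i →
              shift X (i ℕ.+ suc (suc m)) * shift Y (j ℕ.+ n) ≼ shift X (j ℕ.+ n) * shift Y (i ℕ.+ suc (suc m))
      pairs {i} {j} j≤1+i = TP₂-shift tp
        (ℕ.≤-trans (ℕ.+-mono-≤ (m≤n⇒m≤1+n j≤1+i) n≤m)
                   (ℕ.≤-reflexive (≡.sym (≡.trans (ℕ.+-suc i (suc m)) (≡.cong suc (ℕ.+-suc i m))))))

    TP₂-next : (∀ h → c h ≼ b h * b (suc h)) → TP₂ X Y → TP₂ (next X) (next Y)
    TP₂-next {X} {Y} bc tp n≤m with m≤n⇒m<n∨m≡n n≤m
    ... | inj₂ ≡.refl = ≼-refl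
    ... | inj₁ (s≤s n≤m′) with m≤n⇒m<n∨m≡n n≤m′
    ...   | inj₂ ≡.refl   = next-*-≼-adjacent {X} {Y} tp (bc _)
    ...   | inj₁ (s≤s n≤m″) = next-*-≼-distant {X} {Y} tp n≤m″

    tableau : ℕ → ℕ → Carrier
    tableau zero    zero    = 1#
    tableau zero    (suc h) = 0#
    tableau (suc n) h       = next (tableau n) h

    module _ (bc : ∀ h → c h ≼ b h * b (suc h)) where

      TP₂-tableau : ∀ n → TP₂ (tableau n) (tableau (suc n))
      TP₂-tableau zero {zero}  {zero} _ = ≼-refl
      TP₂-tableau zero {suc m} {n}    _ = begin
        0# * tableau 1 n                ≈⟨ zeroˡ (tableau 1 n) ⟩
        0#                              ≲⟨ 0≼ ⟩
        tableau 0 n * tableau 1 (suc m) ∎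
      TP₂-tableau (suc n) = TP₂-next bc (TP₂-tableau n)

      tableau-logConvex : ∀ n → tableau (suc n) 0 * tableau (suc n) 0 ≼ tableau n 0 * tableau (suc (suc n)) 0
      tableau-logConvex n = begin
        next u 0 * v 0                        ≈⟨ expandˡ ⟩
        b 0 * (u 0 * v 0) + c 0 * (u 1 * v 0) ≲⟨ +-mono-≼ ≼-refl (*-monoʳ-≼ (TP₂-tableau n z≤n)) ⟩
        b 0 * (u 0 * v 0) + c 0 * (u 0 * v 1) ≈⟨ expandʳ ⟨
        u 0 * next v 0                        ∎
        where
        u v : ℕ → Carrier
        u = tableau n
        v = tableau (suc n)
        expandˡ : next u 0 * v 0 ≈ b 0 * (u 0 * v 0) + c 0 * (u 1 * v 0)
        expandˡ = solve 5 (λ b₀ c₀ x₀ x₁ y₀ → (con 0 :+ b₀ :* x₀ :+ c₀ :* x₁) :* y₀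
                                             := b₀ :* (x₀ :* y₀) :+ c₀ :* (x₁ :* y₀))
                          refl (b 0) (c 0) (u 0) (u 1) (v 0)
        expandʳ : u 0 * next v 0 ≈ b 0 * (u 0 * v 0) + c 0 * (u 0 * v 1)
        expandʳ = solve 5 (λ b₀ c₀ x₀ y₀ y₁ → x₀ :* (con 0 :+ b₀ :* y₀ :+ c₀ :* y₁)
                                             := b₀ :* (x₀ :* y₀) :+ c₀ :* (x₀ :* y₁))
                          refl (b 0) (c 0) (u 0) (v 0) (v 1)

module Polynomials where

  open import Data.Nat using (_+_; _*_; _∸_)
  open import Data.Nat.Properties
  open import Relation.Binary.PropositionalEquality
  open import Algebra.Properties.CommutativeSemigroup +-commutativeSemigroup using (interchange)

  sumTo-cong : ∀ m {f g : ℕ → ℕ} → (∀ {i} → i ≤ m → f i ≡ g i) → sumTo m f ≡ sumTo m g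
  sumTo-cong zero    f≡g = f≡g z≤n
  sumTo-cong (suc m) f≡g = cong₂ _+_ (sumTo-cong m (λ i≤m → f≡g (m≤n⇒m≤1+n i≤m))) (f≡g ≤-refl)

  sumTo-+ : ∀ m (f g : ℕ → ℕ) → sumTo m (λ i → f i + g i) ≡ sumTo m f + sumTo m g
  sumTo-+ zero    f g = refl
  sumTo-+ (suc m) f g = trans (cong (_+ (f (suc m) + g (suc m))) (sumTo-+ m f g))
                              (interchange (sumTo m f) (sumTo m g) (f (suc m)) (g (suc m)))

  sumTo-*ˡ : ∀ m c (f : ℕ → ℕ) → c * sumTo m f ≡ sumTo m (λ i → c * f i)
  sumTo-*ˡ zero    c f = refl
  sumTo-*ˡ (suc m) c f = trans (*-distribˡ-+ c (sumTo m f) (f (suc m)))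
                               (cong (_+ c * f (suc m)) (sumTo-*ˡ m c f))

  sumTo-suc : ∀ m (f : ℕ → ℕ) → sumTo (suc m) f ≡ f 0 + sumTo m (λ i → f (suc i))
  sumTo-suc zero    f = refl
  sumTo-suc (suc m) f = trans (cong (_+ f (suc (suc m))) (sumTo-suc m f)) (+-assoc (f 0) _ _)

  sumTo-reverse : ∀ m (f : ℕ → ℕ) → sumTo m f ≡ sumTo m (λ i → f (m ∸ i))
  sumTo-reverse zero    f = refl
  sumTo-reverse (suc m) f = trans (cong (_+ f (suc m)) (sumTo-reverse m f))
    (trans (+-comm _ (f (suc m))) (sym (sumTo-suc m (λ i → f (suc m ∸ i)))))

  sumTo-head : ∀ m {f : ℕ → ℕ} → (∀ i → f (suc i) ≡ 0) → sumTo m f ≡ f 0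
  sumTo-head zero    _  = refl
  sumTo-head (suc m) f0 = trans (cong₂ _+_ (sumTo-head m f0) (f0 m)) (+-identityʳ _)

  infixl 6 _⊕_
  _⊕_ : Poly → Poly → Poly
  (f ⊕ g) k = f k + g k

  0p : Poly
  0p _ = 0

  linear : ℕ → ℕ → Poly
  linear a b zero          = a
  linear a b (suc zero)    = b
  linear a b (suc (suc _)) = 0

  scale : ℕ → Poly → Poly
  scale c f k = c * f k

  tail : Poly → Poly
  tail f k = f (suc k)

  private
    variable
      f g f′ g′ : Poly

  ·-congˡ : ∀ g → f ≗ f′ → (f · g) ≗ (f′ · g)
  ·-congˡ g f≗f′ m = sumTo-cong m (λ {i} _ → cong (_* g (m ∸ i)) (f≗f′ i))

  ·-congʳ : ∀ f → g ≗ g′ → (f · g) ≗ (f · g′)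
  ·-congʳ f g≗g′ m = sumTo-cong m (λ {i} _ → cong (f i *_) (g≗g′ (m ∸ i)))

  ·-cong : f ≗ f′ → g ≗ g′ → (f · g) ≗ (f′ · g′)
  ·-cong {f′ = f′} {g = g} f≗f′ g≗g′ m = trans (·-congˡ g f≗f′ m) (·-congʳ f′ g≗g′ m)

  ·-comm : ∀ f g → (f · g) ≗ (g · f)
  ·-comm f g m = trans (sumTo-reverse m _) (sumTo-cong m (λ {i} i≤m →
    trans (cong (λ j → f (m ∸ i) * g j) (m∸[m∸n]≡n i≤m)) (*-comm (f (m ∸ i)) (g i))))

  ·-suc : ∀ f g m → (f · g) (suc m) ≡ f 0 * g (suc m) + (tail f · g) m
  ·-suc f g m = sumTo-suc m _

  ·-distribʳ : ∀ f g h → ((f ⊕ g) · h) ≗ ((f · h) ⊕ (g · h))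
  ·-distribʳ f g h m = trans (sumTo-cong m (λ {i} _ → *-distribʳ-+ (h (m ∸ i)) (f i) (g i))) (sumTo-+ m _ _)

  ·-scale : ∀ c f g → (scale c f · g) ≗ scale c (f · g)
  ·-scale c f g m = trans (sumTo-cong m (λ {i} _ → *-assoc c (f i) (g (m ∸ i)))) (sym (sumTo-*ˡ m c _))

  ·-zeroˡ : ∀ f → (0p · f) ≗ 0p
  ·-zeroˡ f m = sumTo-head m (λ _ → refl)

  linear-·-suc : ∀ a b f k → (linear a b · f) (suc k) ≡ a * f (suc k) + b * f k
  linear-·-suc a b f k = trans (·-suc (linear a b) f k) (cong (a * f (suc k) +_) (sumTo-head k (λ _ → refl)))

  ·-identityˡ : ∀ f → (linear 1 0 · f) ≗ f
  ·-identityˡ f zero    = *-identityˡ (f 0)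
  ·-identityˡ f (suc k) = trans (linear-·-suc 1 0 f k) (trans (+-identityʳ _) (*-identityˡ (f (suc k))))

  ·-assoc : ∀ f g h → ((f · g) · h) ≗ (f · (g · h))
  ·-assoc f g h zero    = *-assoc (f 0) (g 0) (h 0)
  ·-assoc f g h (suc m) = begin
    ((f · g) · h) (suc m)
      ≡⟨ ·-suc (f · g) h m ⟩
    f 0 * g 0 * h (suc m) + (tail (f · g) · h) m
      ≡⟨ cong (f 0 * g 0 * h (suc m) +_) (·-congˡ h (·-suc f g) m) ⟩
    f 0 * g 0 * h (suc m) + ((scale (f 0) (tail g) ⊕ (tail f · g)) · h) m
      ≡⟨ cong (f 0 * g 0 * h (suc m) +_) (·-distribʳ (scale (f 0) (tail g)) (tail f · g) h m) ⟩
    f 0 * g 0 * h (suc m) + ((scale (f 0) (tail g) · h) m + ((tail f · g) · h) m)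
      ≡⟨ cong₂ (λ x y → f 0 * g 0 * h (suc m) + (x + y)) (·-scale (f 0) (tail g) h m) (·-assoc (tail f) g h m) ⟩
    f 0 * g 0 * h (suc m) + (f 0 * (tail g · h) m + (tail f · (g · h)) m)
      ≡⟨ sym (+-assoc (f 0 * g 0 * h (suc m)) _ _) ⟩
    f 0 * g 0 * h (suc m) + f 0 * (tail g · h) m + (tail f · (g · h)) m
      ≡⟨ cong (_+ (tail f · (g · h)) m) (trans (cong (_+ f 0 * (tail g · h) m) (*-assoc (f 0) (g 0) (h (suc m))))
                                               (sym (*-distribˡ-+ (f 0) _ _))) ⟩
    f 0 * (g 0 * h (suc m) + (tail g · h) m) + (tail f · (g · h)) m
      ≡⟨ cong (λ x → f 0 * x + (tail f · (g · h)) m) (sym (·-suc g h m)) ⟩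
    f 0 * (g · h) (suc m) + (tail f · (g · h)) m
      ≡⟨ sym (·-suc f (g · h) m) ⟩
    (f · (g · h)) (suc m) ∎
    where open ≡-Reasoning

  polySemiring : CommutativeSemiring _ _
  polySemiring = record
    { Carrier = Poly
    ; _≈_ = _≗_
    ; _+_ = _⊕_
    ; _*_ = _·_
    ; 0# = 0p
    ; 1# = linear 1 0
    ; isCommutativeSemiring = record
      { isSemiring = record
        { isSemiringWithoutAnnihilatingZero = record
          { +-isCommutativeMonoid = record
            { isMonoid = record
              { isSemigroup = record
                { isMagma = record
                  { isEquivalence = record
                    { refl = λ _ → refl ; sym = λ p k → sym (p k) ; trans = λ p q k → trans (p k) (q k) }
                  ; ∙-cong = λ p q k → cong₂ _+_ (p k) (q k) }
                ; assoc = λ f g h k → +-assoc (f k) (g k) (h k) }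
              ; identity = (λ f k → refl) , (λ f k → +-identityʳ (f k)) }
            ; comm = λ f g k → +-comm (f k) (g k) }
          ; *-cong = ·-cong
          ; *-assoc = ·-assoc
          ; *-identity = ·-identityˡ , (λ f k → trans (·-comm f (linear 1 0) k) (·-identityˡ f k))
          ; distrib = (λ f g h k → trans (·-comm f (g ⊕ h) k)
                                         (trans (·-distribʳ g h f k) (cong₂ _+_ (·-comm g f k) (·-comm h f k))))
                    , (λ f g h → ·-distribʳ g h f) }
        ; zero = ·-zeroˡ , (λ f k → trans (·-comm f 0p k) (·-zeroˡ f k)) }
      ; *-comm = ·-comm }
    }

module EulerianTableau where

  open import Data.Nat using (_+_; _*_; _∸_; _<_)
  open import Data.Nat.Properties
  open import Relation.Binary.PropositionalEquality

  mutual
    E : ℕ → ℕ → ℕ → ℕ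
    E zero    zero    zero    = 1
    E zero    zero    (suc k) = 0
    E zero    (suc h) k       = 0
    E (suc n) h       k       = E-left n h k + (h + k) * E n h k + (2 + n ∸ k) * E-below n h k

    E-left : ℕ → ℕ → ℕ → ℕ
    E-left n zero    k = 0
    E-left n (suc h) k = E n h k

    E-below : ℕ → ℕ → ℕ → ℕ
    E-below n h zero    = 0
    E-below n h (suc k) = E n h k

  mutual
    E-vanishes : ∀ n h k → n < h + k → E n h k ≡ 0
    E-vanishes zero    zero    (suc k) _ = refl
    E-vanishes zero    (suc h) k       _ = refl
    E-vanishes (suc n) h       k       n<h+k
      rewrite E-left-vanishes n h k n<h+k
            | E-vanishes n h k (<-trans (n<1+n n) n<h+k)
            | E-below-vanishes n h k n<h+k
            = cong₂ _+_ (*-zeroʳ (h + k)) (*-zeroʳ (2 + n ∸ k))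

    E-left-vanishes : ∀ n h k → suc n < h + k → E-left n h k ≡ 0
    E-left-vanishes n zero    k _           = refl
    E-left-vanishes n (suc h) k (s≤s n<h+k) = E-vanishes n h k n<h+k

    E-below-vanishes : ∀ n h k → suc n < h + k → E-below n h k ≡ 0
    E-below-vanishes n h zero    _       = refl
    E-below-vanishes n h (suc k) 1+n<h+k =
      E-vanishes n h k (≤-pred (subst (suc (suc n) ≤_) (+-suc h k) 1+n<h+k))

  E-eulerian : ∀ n k → E n 0 k ≡ eulerian n k
  E-eulerian zero    zero    = refl
  E-eulerian zero    (suc k) = refl
  E-eulerian (suc n) zero    = *-zeroʳ (2 + n)
  E-eulerian (suc n) (suc k) =
    cong₂ _+_ (cong (suc k *_) (E-eulerian n (suc k)))
              (trans (coefficient k) (cong ((n ∸ k + 1) *_) (E-eulerian n k)))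
    where
    coefficient : ∀ k → (suc n ∸ k) * E n 0 k ≡ (n ∸ k + 1) * E n 0 k
    coefficient k with ≤-<-connex k n
    ... | inj₁ k≤n = cong (_* E n 0 k) (trans (+-∸-assoc 1 k≤n) (+-comm 1 (n ∸ k)))
    ... | inj₂ n<k rewrite E-vanishes n 0 k n<k = trans (*-zeroʳ (suc n ∸ k)) (sym (*-zeroʳ (n ∸ k + 1)))

  E-jacobi-zero : ∀ n h → E (suc n) h 0 ≡ E-left n h 0 + h * E n h 0
  E-jacobi-zero n h = trans (cong₂ _+_ (cong (λ j → E-left n h 0 + j * E n h 0) (+-identityʳ h)) (*-zeroʳ (2 + n)))
                            (+-identityʳ _)

module EulerianIdentity where

  open EulerianTableau
  open import Data.Nat using (_∸_)
  open import Data.Integer using (ℤ; +_; 0ℤ; 1ℤ; _+_; _*_; _-_)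
  import Data.Integer.Properties as ℤ
  open import Data.Integer.Tactic.RingSolver using (solve-∀)
  open import Relation.Binary.PropositionalEquality
  open ≡-Reasoning

  -- (2 + n ∸ k) only multiplies entries that vanish when k > 2 + n
  E-suc-ℤ : ∀ n h k → + E (suc n) h k
          ≡ + E-left n h k + (+ h + + k) * + E n h k + (+ (2 ℕ.+ n) - + k) * + E-below n h k
  E-suc-ℤ n h k =
    cong₂ (λ x y → + E-left n h k + x + y) (ℤ.pos-* (h ℕ.+ k) (E n h k))
          (trans (ℤ.pos-* (2 ℕ.+ n ∸ k) (E-below n h k)) coefficient)
    where
    coefficient : + (2 ℕ.+ n ∸ k) * + E-below n h k ≡ (+ (2 ℕ.+ n) - + k) * + E-below n h k
    coefficient with ℕ.≤-<-connex k (2 ℕ.+ n)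
    ... | inj₁ k≤2+n = cong (_* + E-below n h k) (trans (sym (ℤ.⊖-≥ k≤2+n)) (sym (ℤ.m-n≡m⊖n (2 ℕ.+ n) k)))
    ... | inj₂ 2+n<k rewrite E-below-vanishes n h k (ℕ.≤-trans (ℕ.<⇒≤ 2+n<k) (ℕ.m≤n+m k h)) =
      trans (ℤ.*-zeroʳ (+ (2 ℕ.+ n ∸ k))) (sym (ℤ.*-zeroʳ (+ (2 ℕ.+ n) - + k)))

  cancel : ∀ {l r x y : ℤ} → x ≡ y → l ≡ r + (x - y) → l ≡ r
  cancel {r = r} {y = y} refl l≡r+0 = trans l≡r+0 (trans (cong (λ z → r + z) (ℤ.+-inverseʳ y)) (ℤ.+-identityʳ r))

  -- The identity at n + 1 is the combination (left identity) + (h + k + 1) (identity)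
  -- + (n + 2 - k) (lower identity) of instances at n.
  identity-step : ∀ N H K p₀ p₁ a c r e f {G₀ G₁ G₂ : ℤ} →
    G₁ ≡ p₁ + (H + (1ℤ + K)) * a + (+ 2 + N - (1ℤ + K)) * c →
    G₀ ≡ p₀ + (H + K) * c + (+ 2 + N - K) * r →
    G₂ ≡ c + (1ℤ + H + K) * e + (+ 2 + N - K) * f →
    (1ℤ + K) * p₁ + N * p₀ ≡ H * H * c + (K + (H - 1ℤ)) * p₀ →
    (1ℤ + K) * a + N * c ≡ (1ℤ + H) * (1ℤ + H) * e + (K + H) * c →
    K * c + N * r ≡ (1ℤ + H) * (1ℤ + H) * f + (K - 1ℤ + H) * r →
    (1ℤ + K) * G₁ + (1ℤ + N) * G₀ ≡ (1ℤ + H) * (1ℤ + H) * G₂ + (K + H) * G₀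
  identity-step N H K p₀ p₁ a c r e f refl refl refl left middle below =
    cancel (cong₂ _+_ (cong₂ _+_ left (cong ((1ℤ + H + K) *_) middle)) (cong ((+ 2 + N - K) *_) below))
           (combination N H K p₀ p₁ a c r e f)
    where
    combination : ∀ N H K p₀ p₁ a c r e f →
      (1ℤ + K) * (p₁ + (H + (1ℤ + K)) * a + (+ 2 + N - (1ℤ + K)) * c)
        + (1ℤ + N) * (p₀ + (H + K) * c + (+ 2 + N - K) * r)
      ≡ (1ℤ + H) * (1ℤ + H) * (c + (1ℤ + H + K) * e + (+ 2 + N - K) * f)
        + (K + H) * (p₀ + (H + K) * c + (+ 2 + N - K) * r)
        + (((1ℤ + K) * p₁ + N * p₀ + (1ℤ + H + K) * ((1ℤ + K) * a + N * c) + (+ 2 + N - K) * (K * c + N * r))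
          - (H * H * c + (K + (H - 1ℤ)) * p₀ + (1ℤ + H + K) * ((1ℤ + H) * (1ℤ + H) * e + (K + H) * c)
             + (+ 2 + N - K) * ((1ℤ + H) * (1ℤ + H) * f + (K - 1ℤ + H) * r)))
    combination = solve-∀

  *-zeroʳ-sums : ∀ a b c d → a * 0ℤ + b * 0ℤ ≡ c * 0ℤ + d * 0ℤ
  *-zeroʳ-sums = solve-∀

  E-identity : ∀ n h k → + suc k * + E n h (suc k) + + n * + E n h k
                       ≡ + suc h * + suc h * + E n (suc h) k + (+ k + + h) * + E n h k
  E-identity zero    zero    zero    = refl
  E-identity zero    zero    (suc k) = *-zeroʳ-sums (+ suc (suc k)) 0ℤ (+ 1 * + 1) (+ suc k + 0ℤ)
  E-identity zero    (suc h) k       = *-zeroʳ-sums (+ suc k) 0ℤ (+ suc (suc h) * + suc (suc h)) (+ k + + suc h)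
  E-identity (suc n) h       k       =
    identity-step (+ n) (+ h) (+ k) (+ E-left n h k) (+ E-left n h (suc k)) (+ E n h (suc k)) (+ E n h k)
                  (+ E-below n h k) (+ E n (suc h) k) (+ E-below n (suc h) k)
                  (E-suc-ℤ n h (suc k)) (E-suc-ℤ n h k) (E-suc-ℤ n (suc h) k)
                  (left h) (E-identity n h k) (below k)
    where
    left : ∀ h → + suc k * + E-left n h (suc k) + + n * + E-left n h k
               ≡ + h * + h * + E n h k + (+ k + (+ h - 1ℤ)) * + E-left n h k
    left zero    = *-zeroʳ-sums (+ suc k) (+ n) 0ℤ (+ k + (0ℤ - 1ℤ))
    left (suc h) = E-identity n h k
    below : ∀ k → + k * + E n h k + + n * + E-below n h k
                ≡ + suc h * + suc h * + E-below n (suc h) k + (+ k - 1ℤ + + h) * + E-below n h k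
    below zero    = *-zeroʳ-sums 0ℤ (+ n) (+ suc h * + suc h) (0ℤ - 1ℤ + + h)
    below (suc k) = E-identity n h k

  jacobi-step : ∀ N H K p a c e {G : ℤ} →
    G ≡ p + (H + (1ℤ + K)) * a + (+ 2 + N - (1ℤ + K)) * c →
    (1ℤ + K) * a + N * c ≡ (1ℤ + H) * (1ℤ + H) * e + (K + H) * c →
    G ≡ p + (H * a + (1ℤ + H) * c) + (1ℤ + H) * (1ℤ + H) * e
  jacobi-step N H K p a c e refl identity = cancel identity (rearrangement N H K p a c e)
    where
    rearrangement : ∀ N H K p a c e →
      p + (H + (1ℤ + K)) * a + (+ 2 + N - (1ℤ + K)) * c
      ≡ p + (H * a + (1ℤ + H) * c) + (1ℤ + H) * (1ℤ + H) * e
        + (((1ℤ + K) * a + N * c) - ((1ℤ + H) * (1ℤ + H) * e + (K + H) * c))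
    rearrangement = solve-∀

  E-jacobi-suc : ∀ n h k → E (suc n) h (suc k)
               ≡ E-left n h (suc k) ℕ.+ (h ℕ.* E n h (suc k) ℕ.+ suc h ℕ.* E n h k)
                 ℕ.+ suc h ℕ.* suc h ℕ.* E n (suc h) k
  E-jacobi-suc n h k = ℤ.+-injective (begin
    + E (suc n) h (suc k)
      ≡⟨ jacobi-step (+ n) (+ h) (+ k) (+ E-left n h (suc k)) (+ E n h (suc k)) (+ E n h k) (+ E n (suc h) k)
                     (E-suc-ℤ n h (suc k)) (E-identity n h k) ⟩
    + E-left n h (suc k) + (+ h * + E n h (suc k) + + suc h * + E n h k) + + suc h * + suc h * + E n (suc h) k
      ≡⟨ cong₂ (λ x y → + E-left n h (suc k) + x + y)
               (cong₂ _+_ (ℤ.pos-* h (E n h (suc k))) (ℤ.pos-* (suc h) (E n h k)))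
               (trans (ℤ.pos-* (suc h ℕ.* suc h) (E n (suc h) k))
                      (cong (_* + E n (suc h) k) (ℤ.pos-* (suc h) (suc h)))) ⟨
    + (E-left n h (suc k) ℕ.+ (h ℕ.* E n h (suc k) ℕ.+ suc h ℕ.* E n h k)
       ℕ.+ suc h ℕ.* suc h ℕ.* E n (suc h) k) ∎)

module EulerianPolynomials where

  open import Data.Nat using (_+_; _*_; _∸_)
  open import Data.Nat.Properties
  open import Relation.Binary.PropositionalEquality
  open Polynomials
  open JacobiTableau polySemiring
  open EulerianTableau
  open EulerianIdentity

  jacobiB jacobiC : ℕ → Poly
  jacobiB h = linear h (suc h)
  jacobiC h = linear 0 (suc h * suc h)

  ≤q⇒≼ : ∀ {f g} → f ≤q g → f ≼ g
  ≤q⇒≼ {f} {g} f≤g = (λ k → g k ∸ f k) , (λ k → m+[n∸m]≡n (f≤g k))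

  ≼⇒≤q : ∀ {f g} → f ≼ g → f ≤q g
  ≼⇒≤q {f} (d , f⊕d≗g) k = ≤-trans (m≤m+n (f k) (d k)) (≤-reflexive (f⊕d≗g k))

  jacobiC≼jacobiB² : ∀ h → jacobiC h ≼ jacobiB h · jacobiB (suc h)
  jacobiC≼jacobiB² h = ≤q⇒≼ λ where
    zero          → z≤n
    (suc zero)    → ≤-trans (m≤n+m _ (h * suc (suc h)))
                            (≤-reflexive (sym (linear-·-suc h (suc h) (jacobiB (suc h)) 0)))
    (suc (suc k)) → z≤n

  shift-E : ∀ n h k → shift (E n) h k ≡ E-left n h k
  shift-E n zero    k = refl
  shift-E n (suc h) k = refl

  E-next : ∀ n h → next jacobiB jacobiC (E n) h ≗ E (suc n) h
  E-next n h zero    = trans (+-identityʳ _) (trans (cong (_+ h * E n h 0) (shift-E n h 0)) (sym (E-jacobi-zero n h)))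
  E-next n h (suc k) = trans (cong₂ _+_ (cong₂ _+_ (shift-E n h (suc k)) (linear-·-suc h (suc h) (E n h) k))
                                        (linear-·-suc 0 (suc h * suc h) (E n (suc h)) k))
                             (sym (E-jacobi-suc n h k))

  tableau-E : ∀ n h → tableau jacobiB jacobiC n h ≗ E n h
  tableau-E zero    zero    zero          = refl
  tableau-E zero    zero    (suc zero)    = refl
  tableau-E zero    zero    (suc (suc k)) = refl
  tableau-E zero    (suc h) k             = refl
  tableau-E (suc n) h       k             = trans (next-cong jacobiB jacobiC (tableau-E n) h k) (E-next n h k)

  column₀ : ℕ → Poly
  column₀ n = tableau jacobiB jacobiC n 0

  first-column : ∀ n → column₀ n ≗ eulerPoly n
  first-column n k = trans (tableau-E n 0 k) (E-eulerian n k)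

open Polynomials using (polySemiring; ·-cong)
open JacobiTableau polySemiring using (≼-preorder; tableau-logConvex)
open EulerianPolynomials

proposition4p6 : QLogConvex eulerPoly
proposition4p6 (suc n) _ = ≼⇒≤q (begin
  eulerPoly (suc n) · eulerPoly (suc n) ≈⟨ ·-cong (first-column (suc n)) (first-column (suc n)) ⟨
  column₀ (suc n) · column₀ (suc n)     ≲⟨ tableau-logConvex jacobiB jacobiC jacobiC≼jacobiB² n ⟩
  column₀ n · column₀ (suc (suc n))     ≈⟨ ·-cong (first-column n) (first-column (suc (suc n))) ⟩
  eulerPoly n · eulerPoly (suc (suc n)) ∎)
  where open import Relation.Binary.Reasoning.Preorder ≼-preorder
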